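{- Let $(G,\sigma)$ be a connected un2qBMG and let $(T,\sigma,u)$ be a least-resolved tree explaining $G$. Then for every internal vertex $v$ of $T$, the subtree $T(v)$ rooted at $v$ is not monochromatic, i.e., its leaves do not all have the same color.
   Context: All trees are rooted (root $\rho$) and phylogenetic (every non-leaf vertex has at least two children); $L(T)$ is the leaf set; $a\preceq b$ means $a$ is a descendant of or equal to $b$; $\mathrm{lca}$ is the last common ancestor. A un2qBMG is the underlying undirected graph of a 2-colored quasi-best match graph; equivalently, a vertex-colored graph explained by some tree in the following sense. A tree $(T,\sigma,u)$ with $\sigma$ a leaf-coloring into two colors and $u(x)\in\{x,\rho\}$ for each leaf $x$ explains $(G,\sigma)$ if $V(G)=L(T)$ and for leaves $x,y$: $xy\in E(G)$ iff $\sigma(x)\neq\sigma(y)$ and either (a) $u(x)\neq x$ and $y\preceq\mathrm{lca}(x,z)$ for all leaves $z$ with $\sigma(z)=\sigma(y)$, or (b) $u(y)\neq y$ and $x\preceq\mathrm{lca}(y,z)$ for all leaves $z$ with $\sigma(z)=\sigma(x)$. A tree explaining $G$ is least-resolved if no tree $(T',\sigma,u')$ explaining $G$ has $T'$ obtained from $T$ by a nonempty sequence of contractions of internal arcs. -}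

module Defs where

open import Data.Nat using (ℕ; zero; suc)
open import Data.Fin using (Fin)
open import Data.Sum using (_⊎_; inj₁; inj₂)
open import Data.Product using (Σ; ∃; ∃-syntax; _×_; _,_)
open import Relation.Binary.PropositionalEquality using (_≡_; _≢_)
open import Relation.Nullary using (¬_)
open import Relation.Binary.Construct.Closure.Transitive using (TransClosure)
open import Relation.Binary.Construct.Closure.ReflexiveTransitive using (Star)

iter : {A : Set} → (A → A) → ℕ → A → A
iter f zero    a = a
iter f (suc n) a = f (iter f n a)

-- Vertices of a rooted tree with leaf set Fin m and k non-leaf vertices:
-- inj₁ i is the leaf i, inj₂ j is the j-th internal vertex.
V : ℕ → ℕ → Set
V m k = Fin m ⊎ Fin k

-- A rooted phylogenetic tree on leaf set Fin m, given by a parent map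
-- (the root is its own parent).
record Tree (m k : ℕ) : Set where
  field
    root   : V m k
    parent : V m k → V m k
    parent-root : parent root ≡ root
    fix-root    : ∀ x → parent x ≡ x → x ≡ root
    -- every vertex reaches the root (so the parent graph is a tree)
    reach-root  : ∀ x → ∃[ n ] iter parent n x ≡ root
    leaf-nochild : ∀ x i → parent x ≡ inj₁ i → x ≡ inj₁ i
    phylo : ∀ j → ∃[ x ] ∃[ y ] (x ≢ y × parent x ≡ inj₂ j × parent y ≡ inj₂ j
                                  × x ≢ inj₂ j × y ≢ inj₂ j)

module _ {m k : ℕ} (T : Tree m k) where
  open Tree T

  _⪯_ : V m k → V m k → Set
  a ⪯ b = ∃[ n ] iter parent n a ≡ b

  IsLca : V m k → V m k → V m k → Set
  IsLca a b w = a ⪯ w × b ⪯ w × (∀ w' → a ⪯ w' → b ⪯ w' → w ⪯ w')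

record Graph (m : ℕ) : Set₁ where
  field
    Adj : Fin m → Fin m → Set

Connected : {m : ℕ} → Graph m → Set
Connected {m} G = ∀ (x y : Fin m) → Star (Graph.Adj G) x y

Explains : {m k : ℕ} → (T : Tree m k) → (σ : Fin m → Fin 2) → (u : Fin m → V m k)
         → Graph m → Set
Explains {m} {k} T σ u G =
  (∀ x → u x ≡ inj₁ x ⊎ u x ≡ Tree.root T) ×
  (∀ x y → Graph.Adj G x y ⇔' (σ x ≢ σ y × (Cond x y ⊎ Cond y x)))
  where
    _⇔'_ : Set → Set → Set
    A ⇔' B = (A → B) × (B → A)
    Cond : Fin m → Fin m → Set
    Cond x y = u x ≢ inj₁ x ×
      (∀ z → σ z ≡ σ y → ∀ w → IsLca T (inj₁ x) (inj₁ z) w → _⪯_ T (inj₁ y) w)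

extend : {m k k' : ℕ} → (Fin k → Fin k') → V m k → V m k'
extend φ (inj₁ i) = inj₁ i
extend φ (inj₂ j) = inj₂ (φ j)

-- T' is (isomorphic to) the tree obtained from T by contracting the
-- internal arc (parent v, v), where v ≠ root and v, parent v are internal.
ContractStep : {m : ℕ} → Σ ℕ (Tree m) → Σ ℕ (Tree m) → Set
ContractStep {m} (k , T) (k' , T') =
  ∃[ j ] ∃[ j₀ ] (inj₂ j ≢ Tree.root T × Tree.parent T (inj₂ j) ≡ inj₂ j₀ ×
    ∃[ φ ] (
      (∀ j' → ∃[ i ] φ i ≡ j') ×
      φ j ≡ φ j₀ ×
      (∀ a b → φ a ≡ φ b → a ≡ b ⊎ (a ≡ j × b ≡ j₀) ⊎ (a ≡ j₀ × b ≡ j)) ×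
      extend φ (Tree.root T) ≡ Tree.root T' ×
      (∀ x → x ≢ inj₂ j → Tree.parent T' (extend φ x) ≡ extend φ (Tree.parent T x))))

ObtainedByContraction : {m k k' : ℕ} → Tree m k → Tree m k' → Set
ObtainedByContraction {m} {k} {k'} T T' = TransClosure (ContractStep {m}) (k , T) (k' , T')

LeastResolved : {m k : ℕ} → (T : Tree m k) → (σ : Fin m → Fin 2) → (u : Fin m → V m k)
              → Graph m → Set
LeastResolved {m} {k} T σ u G =
  Explains T σ u G ×
  ¬ (Σ ℕ λ k' → Σ (Tree m k') λ T' → Σ (Fin m → V m k') λ u' →
        ObtainedByContraction T T' × Explains T' σ u' G)

-- If the leaves below an internal vertex v ≠ ρ all have one colour, then contracting the arc
-- (parent v, v) changes no quasi-best-match condition: such a condition only compares the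
-- ancestor relation with last common ancestors of two differently coloured leaves, and v is
-- never one of those.  So a least-resolved tree has no monochromatic internal non-root vertex.
-- At the root ρ, whose subtree contains every leaf, monochromacy would leave the graph without
-- edges; a connected graph then has a single leaf, so ρ has an internal child, which is a
-- non-root monochromatic vertex.
module Submission where

open import Defs
open import Data.Nat using (ℕ; zero; suc; s≤s; _+_; _≤′_; ≤′-refl; ≤′-step)
open import Data.Nat.Properties using (≤-total; ≤⇒≤′)
open import Data.Fin using (Fin; toℕ; fromℕ; fromℕ<; punchIn; punchOut)
open import Data.Fin.Properties
  using (any?; toℕ-fromℕ; toℕ-fromℕ<; punchInᵢ≢i; punchOut-cong; punchOut-injective;
         punchIn-punchOut; punchOut-punchIn)
import Data.Fin.Properties as Fin
open import Data.Sum using (_⊎_; inj₁; inj₂; fromInj₁) renaming (map to ⊎-map)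
open import Data.Sum.Properties using (≡-dec; inj₂-injective)
open import Data.Product using (∃-syntax; _×_; _,_; proj₁; proj₂)
open import Data.Empty using (⊥-elim)
open import Function using (_∘_; flip; _⇔_; mk⇔; Equivalence)
open import Relation.Nullary using (¬_; Dec; yes; no; _×-dec_; ¬?)
open import Relation.Nullary.Decidable using (map′; decidable-stable)
open import Relation.Binary.Definitions using (DecidableEquality)
open import Relation.Binary.PropositionalEquality
open import Relation.Binary.Construct.Closure.Transitive using ([_])
open import Relation.Binary.Construct.Closure.ReflexiveTransitive using (ε; _◅_)

Reach : {A : Set} → (A → A) → A → A → Set
Reach f a b = ∃[ n ] iter f n a ≡ b

module _ {A : Set} {f : A → A} where

  iter-+ : ∀ n n' a → iter f (n + n') a ≡ iter f n (iter f n' a)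
  iter-+ zero    n' a = refl
  iter-+ (suc n) n' a = cong f (iter-+ n n' a)

  Reach-trans : ∀ {a b c} → Reach f a b → Reach f b c → Reach f a c
  Reach-trans {a} (n , refl) (n' , refl) = n' + n , iter-+ n' n a

  iter-stable : ∀ {r a N n} → f r ≡ r → iter f N a ≡ r → N ≤′ n → iter f n a ≡ r
  iter-stable fr aN ≤′-refl       = aN
  iter-stable fr aN (≤′-step N≤n) = trans (cong f (iter-stable fr aN N≤n)) fr

  -- Once a reaches a fixed point r in N steps, only the first N + 1 iterates can be new.
  Reach-dec : DecidableEquality A → ∀ {r a} → f r ≡ r → Reach f a r → ∀ b → Dec (Reach f a b)
  Reach-dec _≟_ {r} {a} fr (N , aN) b =
    map′ (λ (i , e) → toℕ i , e) bounded (any? λ (i : Fin (suc N)) → iter f (toℕ i) a ≟ b)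
    where
    bounded : Reach f a b → ∃[ i ] iter f (toℕ {suc N} i) a ≡ b
    bounded (n , e) with ≤-total n N
    ... | inj₁ n≤N = fromℕ< (s≤s n≤N) , trans (cong (λ t → iter f t a) (toℕ-fromℕ< (s≤s n≤N))) e
    ... | inj₂ N≤n = fromℕ N , (begin
      iter f (toℕ (fromℕ N)) a ≡⟨ cong (λ t → iter f t a) (toℕ-fromℕ N) ⟩
      iter f N a               ≡⟨ aN ⟩
      r                        ≡⟨ iter-stable fr aN (≤⇒≤′ N≤n) ⟨
      iter f n a               ≡⟨ e ⟩
      b                        ∎)
      where open ≡-Reasoning

module _ {A B : Set} {f : A → A} {g : B → B} (h : A → B) where

  Reach-map : (∀ a → Reach g (h a) (h (f a))) → ∀ {a b} → Reach f a b → Reach g (h a) (h b)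
  Reach-map step (zero  , refl) = 0 , refl
  Reach-map step {a} (suc n , refl) = Reach-trans (Reach-map step (n , refl)) (step (iter f n a))

  iter-simulate : (∀ a → ∃[ n ] g (h a) ≡ h (iter f n a))
                → ∀ n a → ∃[ n' ] iter g n (h a) ≡ h (iter f n' a)
  iter-simulate sim zero    a = 0 , refl
  iter-simulate sim (suc n) a with iter-simulate sim n a
  ... | n' , e with sim (iter f n' a)
  ... | n'' , e' = n'' + n' , trans (cong g e) (trans e' (cong h (sym (iter-+ n'' n' a))))

  Reach-reflect : (∀ a → ∃[ n ] g (h a) ≡ h (iter f n a))
                → ∀ {a c} → Reach g (h a) c → ∃[ b ] Reach f a b × h b ≡ c
  Reach-reflect sim {a} (n , e) with iter-simulate sim n a
  ... | n' , e' = iter f n' a , (n' , refl) , trans (sym e') e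

TwoChildren : {A : Set} → (A → A) → A → Set
TwoChildren f w = ∃[ x ] ∃[ y ] (x ≢ y × f x ≡ w × f y ≡ w × x ≢ w × y ≢ w)

module TreeProperties {m k : ℕ} (T : Tree m k) where
  open Tree T

  _≟V_ : DecidableEquality (V m k)
  _≟V_ = ≡-dec Fin._≟_ Fin._≟_

  ⪯-dec : ∀ a b → Dec (_⪯_ T a b)
  ⪯-dec a = Reach-dec _≟V_ parent-root (reach-root a)

  parent²≡⇒root : ∀ {x} → parent (parent x) ≡ x → x ≡ root
  parent²≡⇒root {x} e with reach-root x
  ... | n , xn with alternate n
    where
    alternate : ∀ n → iter parent n x ≡ x ⊎ iter parent n x ≡ parent x
    alternate zero    = inj₁ refl
    alternate (suc n) with alternate n
    ... | inj₁ x' = inj₂ (cong parent x')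
    ... | inj₂ x' = inj₁ (trans (cong parent x') e)
  ... | inj₁ xn≡x = trans (sym xn≡x) xn
  ... | inj₂ xn≡px = trans (sym e) (trans (cong parent (trans (sym xn≡px) xn)) parent-root)

  parent-internal : ∀ j → ∃[ j₀ ] parent (inj₂ j) ≡ inj₂ j₀
  parent-internal j with parent (inj₂ j) in e
  ... | inj₁ i with () ← leaf-nochild (inj₂ j) i e
  ... | inj₂ j₀ = j₀ , refl

module _ {m k : ℕ} (T : Tree m k) (σ : Fin m → Fin 2) where
  open TreeProperties T using (⪯-dec)

  Monochromatic : V m k → Set
  Monochromatic w = ∀ {a b} → _⪯_ T (inj₁ a) w → _⪯_ T (inj₁ b) w → σ a ≡ σ b

  Bichromatic : V m k → Set
  Bichromatic w = ∃[ x ] ∃[ y ] (_⪯_ T (inj₁ x) w × _⪯_ T (inj₁ y) w × σ x ≢ σ y)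

  Monochromatic-below : ∀ {c w} → _⪯_ T c w → Monochromatic w → Monochromatic c
  Monochromatic-below c⪯w mono a⪯c b⪯c = mono (Reach-trans a⪯c c⪯w) (Reach-trans b⪯c c⪯w)

  bichromatic-or-monochromatic : ∀ w → Bichromatic w ⊎ Monochromatic w
  bichromatic-or-monochromatic w with any? (λ x → any? (λ y →
    ⪯-dec (inj₁ x) w ×-dec ⪯-dec (inj₁ y) w ×-dec ¬? (σ x Fin.≟ σ y)))
  ... | yes bichromatic = inj₁ bichromatic
  ... | no ¬bichromatic = inj₂ λ {a} {b} a⪯w b⪯w →
    decidable-stable (σ a Fin.≟ σ b) λ σa≢σb → ¬bichromatic (a , b , a⪯w , b⪯w , σa≢σb)

  QuasiBestMatch : (Fin m → V m k) → Fin m → Fin m → Set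
  QuasiBestMatch u x y = u x ≢ inj₁ x ×
    (∀ z → σ z ≡ σ y → ∀ w → IsLca T (inj₁ x) (inj₁ z) w → _⪯_ T (inj₁ y) w)

Explains-transfer : ∀ {m k k'} {T : Tree m k} {T' : Tree m k'} {σ u u'} {G : Graph m}
  → (∀ x → u' x ≡ inj₁ x ⊎ u' x ≡ Tree.root T')
  → (∀ {x y} → σ x ≢ σ y → QuasiBestMatch T σ u x y ⇔ QuasiBestMatch T' σ u' x y)
  → Explains T σ u G → Explains T' σ u' G
Explains-transfer u'-valid qbm⇔ (_ , adj) = u'-valid , λ x y →
  (λ xy → let (σx≢σy , qbm) = proj₁ (adj x y) xy
          in σx≢σy , ⊎-map (to (qbm⇔ σx≢σy)) (to (qbm⇔ (σx≢σy ∘ sym))) qbm) ,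
  (λ (σx≢σy , qbm) →
     proj₂ (adj x y) (σx≢σy , ⊎-map (from (qbm⇔ σx≢σy)) (from (qbm⇔ (σx≢σy ∘ sym))) qbm))
  where open Equivalence

-- Contraction of the arc (p, v) with v = inj₂ j and p = inj₂ j₀ its parent: internal vertex j
-- is deleted by punching it out of Fin (suc k), and v is sent to the image of p.
module Contraction {m k : ℕ} (T : Tree m (suc k)) {j j₀ : Fin (suc k)}
  (v≢root : inj₂ j ≢ Tree.root T) (parent-v : Tree.parent T (inj₂ j) ≡ inj₂ j₀) where
  open Tree T
  open TreeProperties T

  v p : V m (suc k)
  v = inj₂ j
  p = inj₂ j₀

  j≢j₀ : j ≢ j₀
  j≢j₀ refl = v≢root (fix-root v parent-v)

  v≢p : v ≢ p
  v≢p = j≢j₀ ∘ inj₂-injective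

  parent-p≢v : parent p ≢ v
  parent-p≢v e = v≢root (parent²≡⇒root (trans (cong parent parent-v) e))

  φ : Fin (suc k) → Fin k
  φ a with a Fin.≟ j
  ... | yes _  = punchOut j≢j₀
  ... | no a≢j = punchOut (a≢j ∘ sym)

  φ-punchIn : ∀ b → φ (punchIn j b) ≡ b
  φ-punchIn b with punchIn j b Fin.≟ j
  ... | yes c≡j = ⊥-elim (punchInᵢ≢i j b c≡j)
  ... | no _    = trans (punchOut-cong j refl) (punchOut-punchIn j)

  φ-j≡φ-j₀ : φ j ≡ φ j₀
  φ-j≡φ-j₀ with j Fin.≟ j | j₀ Fin.≟ j
  ... | no j≢j   | _        = ⊥-elim (j≢j refl)
  ... | yes _    | yes j₀≡j = ⊥-elim (j≢j₀ (sym j₀≡j))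
  ... | yes _    | no _     = punchOut-cong j refl

  φ-identifies-only-j-j₀ : ∀ a b → φ a ≡ φ b → a ≡ b ⊎ (a ≡ j × b ≡ j₀) ⊎ (a ≡ j₀ × b ≡ j)
  φ-identifies-only-j-j₀ a b e with a Fin.≟ j | b Fin.≟ j
  ... | yes a≡j | yes b≡j = inj₁ (trans a≡j (sym b≡j))
  ... | yes a≡j | no b≢j  = inj₂ (inj₁ (a≡j , sym (punchOut-injective j≢j₀ _ e)))
  ... | no a≢j  | yes b≡j = inj₂ (inj₂ (punchOut-injective _ j≢j₀ e , b≡j))
  ... | no a≢j  | no b≢j  = inj₁ (punchOut-injective (a≢j ∘ sym) (b≢j ∘ sym) e)

  E : V m (suc k) → V m k
  E = extend φ

  pre : V m k → V m (suc k)
  pre = extend (punchIn j)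

  E-pre : ∀ x → E (pre x) ≡ x
  E-pre (inj₁ i) = refl
  E-pre (inj₂ b) = cong inj₂ (φ-punchIn b)

  pre≢v : ∀ x → pre x ≢ v
  pre≢v (inj₁ i) ()
  pre≢v (inj₂ b) = punchInᵢ≢i j b ∘ inj₂-injective

  pre-E : ∀ {x} → x ≢ v → pre (E x) ≡ x
  pre-E {inj₁ i} _ = refl
  pre-E {inj₂ a} x≢v with a Fin.≟ j
  ... | yes refl = ⊥-elim (x≢v refl)
  ... | no a≢j   = cong inj₂ (punchIn-punchOut (a≢j ∘ sym))

  E-injective : ∀ {x y} → x ≢ v → y ≢ v → E x ≡ E y → x ≡ y
  E-injective {x} {y} x≢v y≢v e = trans (sym (pre-E x≢v)) (trans (cong pre e) (pre-E y≢v))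

  Ev≡Ep : E v ≡ E p
  Ev≡Ep = cong inj₂ φ-j≡φ-j₀

  E-leaf : ∀ {x} i → E x ≡ inj₁ i → x ≡ inj₁ i
  E-leaf {inj₁ _} i refl = refl

  parent' : V m k → V m k
  parent' x = E (parent (pre x))

  E-parent : ∀ {x} → x ≢ v → parent' (E x) ≡ E (parent x)
  E-parent x≢v = cong (E ∘ parent) (pre-E x≢v)

  -- One step above v in T' is two steps above v in T.
  parent'-E : ∀ a → ∃[ n ] parent' (E a) ≡ E (iter parent n a)
  parent'-E a with a ≟V v
  ... | no a≢v = 1 , E-parent a≢v
  ... | yes refl = 2 , (begin
    parent' (E v)       ≡⟨ cong parent' Ev≡Ep ⟩
    parent' (E p)       ≡⟨ E-parent (v≢p ∘ sym) ⟩
    E (parent p)        ≡⟨ cong (E ∘ parent) parent-v ⟨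
    E (parent (parent v)) ∎)
    where open ≡-Reasoning

  E-reach-parent : ∀ a → Reach parent' (E a) (E (parent a))
  E-reach-parent a with a ≟V v
  ... | no a≢v   = 1 , E-parent a≢v
  ... | yes refl = 0 , trans Ev≡Ep (cong E (sym parent-v))

  E-mono : ∀ {a b} → Reach parent a b → Reach parent' (E a) (E b)
  E-mono = Reach-map E E-reach-parent

  E-reflect : ∀ {a b} → Reach parent' (E a) (E b) → Reach parent a b ⊎ b ≡ v
  E-reflect {a} {b} a⪯b with b ≟V v | Reach-reflect E parent'-E a⪯b
  ... | yes b≡v | _ = inj₂ b≡v
  ... | no b≢v  | c , a⪯c , Ec≡Eb with c ≟V v
  ...   | no c≢v = inj₁ (subst (Reach parent a) (E-injective c≢v b≢v Ec≡Eb) a⪯c)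
  ...   | yes refl = inj₁ (Reach-trans a⪯c (1 , trans parent-v p≡b))
    where
    p≡b : p ≡ b
    p≡b = E-injective (v≢p ∘ sym) b≢v (trans (sym Ev≡Ep) Ec≡Eb)

  reach-pre : ∀ {a w} → Reach parent' (E a) w → Reach parent a (pre w)
  reach-pre {a} {w} a⪯w with E-reflect (subst (Reach parent' (E a)) (sym (E-pre w)) a⪯w)
  ... | inj₁ a⪯pre = a⪯pre
  ... | inj₂ pre≡v = ⊥-elim (pre≢v w pre≡v)

  fix-root' : ∀ x → parent' x ≡ x → x ≡ E root
  fix-root' x e with parent (pre x) ≟V v
  ... | yes ppre≡v = ⊥-elim (parent-p≢v (subst (λ t → parent t ≡ v) pre≡p ppre≡v))
    where
    pre≡p : pre x ≡ p
    pre≡p = E-injective (pre≢v x) (v≢p ∘ sym)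
      (trans (E-pre x) (trans (sym e) (trans (cong E ppre≡v) Ev≡Ep)))
  ... | no ppre≢v = trans (sym (E-pre x))
    (cong E (fix-root (pre x) (E-injective ppre≢v (pre≢v x) (trans e (sym (E-pre x))))))

  reach-root' : ∀ x → Reach parent' x (E root)
  reach-root' x = subst (λ y → Reach parent' y (E root)) (E-pre x) (E-mono (reach-root (pre x)))

  leaf-nochild' : ∀ x i → parent' x ≡ inj₁ i → x ≡ inj₁ i
  leaf-nochild' x i e = trans (sym (E-pre x)) (cong E (leaf-nochild (pre x) i (E-leaf i e)))

  module _ (b : Fin k) where
    c : V m (suc k)
    c = pre (inj₂ b)

    Ec≡b : E c ≡ inj₂ b
    Ec≡b = E-pre (inj₂ b)

    children' : ∀ {x y} → x ≢ y → x ≢ v → y ≢ v → x ≢ c → y ≢ c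
              → E (parent x) ≡ inj₂ b → E (parent y) ≡ inj₂ b → TwoChildren parent' (inj₂ b)
    children' {x} {y} x≢y x≢v y≢v x≢c y≢c px py =
      E x , E y , x≢y ∘ E-injective x≢v y≢v ,
      trans (E-parent x≢v) px , trans (E-parent y≢v) py ,
      (λ e → x≢c (E-injective x≢v (pre≢v (inj₂ b)) (trans e (sym Ec≡b)))) ,
      (λ e → y≢c (E-injective y≢v (pre≢v (inj₂ b)) (trans e (sym Ec≡b))))

    -- If v is a child of c, then c = p and a child of v replaces it.
    children'-via-v : ∀ {y} → parent v ≡ c → parent y ≡ c → y ≢ v → y ≢ c
                    → TwoChildren parent' (inj₂ b)
    children'-via-v {y} pv py y≢v y≢c with phylo j
    ... | x , _ , _ , px , _ , x≢v , _ =
      children' x≢y x≢v y≢v x≢c y≢c (trans (cong E px) (trans Ev≡Ep Ep≡b)) (trans (cong E py) Ec≡b)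
      where
      p≡c : p ≡ c
      p≡c = trans (sym parent-v) pv
      Ep≡b : E p ≡ inj₂ b
      Ep≡b = trans (cong E p≡c) Ec≡b
      x≢y : x ≢ y
      x≢y refl = v≢p (trans (sym px) (trans py (sym p≡c)))
      x≢c : x ≢ c
      x≢c refl = parent-p≢v (subst (λ t → parent t ≡ v) (sym p≡c) px)

    phylo' : TwoChildren parent' (inj₂ b)
    phylo' with phylo (punchIn j b)
    ... | x , y , x≢y , px , py , x≢c , y≢c with x ≟V v | y ≟V v
    ...   | yes refl | yes refl = ⊥-elim (x≢y refl)
    ...   | yes refl | no y≢v   = children'-via-v px py y≢v y≢c
    ...   | no x≢v   | yes refl = children'-via-v py px x≢v x≢c
    ...   | no x≢v   | no y≢v   =
      children' x≢y x≢v y≢v x≢c y≢c (trans (cong E px) Ec≡b) (trans (cong E py) Ec≡b)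

  T' : Tree m k
  T' = record
    { root         = E root
    ; parent       = parent'
    ; parent-root  = trans (E-parent (v≢root ∘ sym)) (cong E parent-root)
    ; fix-root     = fix-root'
    ; reach-root   = reach-root'
    ; leaf-nochild = leaf-nochild'
    ; phylo        = phylo'
    }

  contract-step : ContractStep (suc k , T) (k , T')
  contract-step = j , j₀ , v≢root , parent-v , φ ,
    (λ b → punchIn j b , φ-punchIn b) , φ-j≡φ-j₀ , φ-identifies-only-j-j₀ , refl , λ _ → E-parent

  lca-E : ∀ {a b w} → IsLca T a b w → IsLca T' (E a) (E b) (E w)
  lca-E (a⪯w , b⪯w , least) = E-mono a⪯w , E-mono b⪯w , λ w' a⪯w' b⪯w' →
    subst (Reach parent' (E _)) (E-pre w')
      (E-mono (least (pre w') (reach-pre a⪯w') (reach-pre b⪯w')))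

  lca-pre : ∀ {a b w'} → (∀ {w} → Reach parent a w → Reach parent b w → w ≢ v)
          → IsLca T' (E a) (E b) w' → IsLca T a b (pre w')
  lca-pre {w' = w'} v-not-common (a⪯w' , b⪯w' , least) =
    reach-pre a⪯w' , reach-pre b⪯w' , λ w a⪯w b⪯w →
      fromInj₁ (⊥-elim ∘ v-not-common a⪯w b⪯w)
        (E-reflect (subst (λ t → Reach parent' t (E w)) (sym (E-pre w'))
          (least (E w) (E-mono a⪯w) (E-mono b⪯w))))

  module _ {σ : Fin m → Fin 2} (mono : Monochromatic T σ v) where

    v-not-common-ancestor : ∀ {x z w} → σ x ≢ σ z
                          → Reach parent (inj₁ x) w → Reach parent (inj₁ z) w → w ≢ v
    v-not-common-ancestor σx≢σz x⪯w z⪯w refl = σx≢σz (mono x⪯w z⪯w)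

    QuasiBestMatch-E : ∀ {u x y} → σ x ≢ σ y
                     → QuasiBestMatch T σ u x y ⇔ QuasiBestMatch T' σ (E ∘ u) x y
    QuasiBestMatch-E {u} {x} {y} σx≢σy = mk⇔
      (λ (ux≢x , best) → ux≢x ∘ E-leaf x , λ z σz≡σy w' lca' →
        subst (Reach parent' (inj₁ y)) (E-pre w')
          (E-mono (best z σz≡σy (pre w')
            (lca-pre (v-not-common-ancestor (σx≢σy ∘ flip trans σz≡σy)) lca'))))
      (λ (ux≢x , best) → ux≢x ∘ cong E , λ z σz≡σy w lca@(x⪯w , z⪯w , _) →
        fromInj₁ (⊥-elim ∘ v-not-common-ancestor (σx≢σy ∘ flip trans σz≡σy) x⪯w z⪯w)
          (E-reflect (best z σz≡σy (E w) (lca-E lca))))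

    contract-explains : ∀ {u G} → Explains T σ u G → Explains T' σ (E ∘ u) G
    contract-explains {u} expl@(u-valid , _) =
      Explains-transfer {T = T} {T' = T'} {u' = E ∘ u}
        (λ x → ⊎-map (cong E) (cong E) (u-valid x)) (QuasiBestMatch-E {u}) expl

module _ {m : ℕ} {G : Graph m} {σ : Fin m → Fin 2} where

  non-root-not-monochromatic : ∀ {k} {T : Tree m k} {u} → LeastResolved T σ u G
    → ∀ j → inj₂ j ≢ Tree.root T → ¬ Monochromatic T σ (inj₂ j)
  non-root-not-monochromatic {zero} _ ()
  non-root-not-monochromatic {suc k} {T} (explains , minimal) j v≢root mono
    with TreeProperties.parent-internal T j
  ... | j₀ , parent-v =
    minimal (k , T' , E ∘ _ , [ contract-step ] , contract-explains mono explains)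
    where open Contraction T v≢root parent-v

  module _ {k} {T : Tree m k} {u : Fin m → V m k} where
    open Tree T
    open TreeProperties T using (_≟V_)

    two-leaves⇒root-not-monochromatic : Connected G → Explains T σ u G
      → ∀ {a b : Fin m} → a ≢ b → ¬ Monochromatic T σ root
    two-leaves⇒root-not-monochromatic connected (_ , adj) {a} {b} a≢b mono with connected a b
    ... | ε = a≢b refl
    ... | a~c ◅ _ = proj₁ (proj₁ (adj a _) a~c) (mono (reach-root (inj₁ a)) (reach-root (inj₁ _)))

    child-of-monochromatic-root-is-leaf : LeastResolved T σ u G → ∀ {w} → w ≡ root
      → Monochromatic T σ w → ∀ {x} → parent x ≡ w → x ≢ w → ∃[ a ] x ≡ inj₁ a
    child-of-monochromatic-root-is-leaf _ _ _ {inj₁ a} _ _ = a , refl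
    child-of-monochromatic-root-is-leaf lr w≡root mono {inj₂ c} pc c≢w =
      ⊥-elim (non-root-not-monochromatic lr c (c≢w ∘ flip trans (sym w≡root))
        (Monochromatic-below T σ (1 , pc) mono))

    root-not-monochromatic : Connected G → LeastResolved T σ u G
      → ∀ {j} → inj₂ j ≡ root → ¬ Monochromatic T σ (inj₂ j)
    root-not-monochromatic connected lr {j} j≡root mono with phylo j
    ... | x , y , x≢y , px , py , x≢j , y≢j
      with child-of-monochromatic-root-is-leaf lr j≡root mono px x≢j
         | child-of-monochromatic-root-is-leaf lr j≡root mono py y≢j
    ... | a , refl | b , refl = two-leaves⇒root-not-monochromatic connected (proj₁ lr)
      (x≢y ∘ cong inj₁) (subst (Monochromatic T σ) j≡root mono)

    internal-not-monochromatic : Connected G → LeastResolved T σ u G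
      → ∀ j → ¬ Monochromatic T σ (inj₂ j)
    internal-not-monochromatic connected lr j with inj₂ j ≟V root
    ... | no j≢root  = non-root-not-monochromatic lr j j≢root
    ... | yes j≡root = root-not-monochromatic connected lr j≡root

corollary3p5 : ∀ {m k : ℕ} (G : Graph m) (σ : Fin m → Fin 2) (T : Tree m k) (u : Fin m → V m k)
    → Connected G
    → LeastResolved T σ u G
    → ∀ (j : Fin k) → ∃[ x ] ∃[ y ] (_⪯_ T (inj₁ x) (inj₂ j) × _⪯_ T (inj₁ y) (inj₂ j) × σ x ≢ σ y)
corollary3p5 G σ T u connected lr j with bichromatic-or-monochromatic T σ (inj₂ j)
... | inj₁ bichromatic = bichromatic
... | inj₂ monochromatic = ⊥-elim (internal-not-monochromatic connected lr j monochromatic)
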